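{- Let $t,p$ be positive integers. For $1\leq i\leq t-1$ let $\gamma_i$ be the partition whose $\beta$-set is \[ \beta(\gamma_i)=\bigcup_{k=1}^{\lfloor (i-1)/p\rfloor+1}\{x\in\mathbb{Z}: kt-(i-(k-1)p)\leq x\leq kt-1\}, \] let $\gamma_0$ be the empty partition, and let $f(i)=|\gamma_i|$ for $0\leq i\leq t-1$. If $0\leq i\leq p$ and $m\geq 0$ are integers with $pm+i\leq t-1$, then \[ f(pm+i)=\binom{m+2}{2}(it-ipm-i^2)+\binom{m+2}{3}(pt-p^2)-3\binom{m+2}{4}p^2. \]
   Context: A partition is a finite weakly decreasing sequence $(\lambda_1,\ldots,\lambda_r)$ of positive integers, with size $|\lambda|=\sum_i\lambda_i$. The $\beta$-set of $\lambda$ is the set of hook lengths $h(i,1)$, $1\leq i\leq r$, of the boxes in the first column of its Young diagram (hook length of a box = number of boxes directly to its right, directly below it, plus itself). Every finite set of positive integers is the $\beta$-set of a unique partition. Binomial coefficients $\binom{a}{b}$ are $0$ when $a<b$; $\lfloor x\rfloor$ is the floor. -}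

module Defs where

open import Data.Nat using (ℕ; zero; suc; _+_; _*_; _∸_; _≤_; _<_; _≤?_; NonZero)
open import Data.Nat.DivMod using (_/_)
open import Data.List using (List; []; _∷_; length; map; filter; drop; upTo)
open import Data.Nat.ListAction using (sum)
open import Data.List.Relation.Unary.All using (All)
open import Data.List.Relation.Unary.Linked using (Linked)
open import Data.List.Membership.Propositional using (_∈_)
open import Data.Integer as ℤ using (ℤ; +_)
open import Data.Product using (Σ; _×_; ∃)
open import Relation.Binary.PropositionalEquality using (_≡_)
open import Function.Bundles using (_⇔_)

IsPartition : List ℕ → Set
IsPartition λ′ = All (1 ≤_) λ′ × Linked (λ a b → b ≤ a) λ′

size : List ℕ → ℕ
size = sum

-- i-th part (1-indexed), 0 if beyond the length
part : List ℕ → ℕ → ℕ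
part []       _             = 0
part (x ∷ xs) zero          = 0
part (x ∷ xs) (suc zero)    = x
part (x ∷ xs) (suc (suc i)) = part xs (suc i)

-- hook length of box (i,j) (1-indexed): arm + leg + 1,
-- arm = λ_i - j (boxes to the right), leg = #{k > i : λ_k ≥ j} (boxes below)
hook : List ℕ → ℕ → ℕ → ℕ
hook λ′ i j = (part λ′ i ∸ j) + length (filter (j ≤?_) (drop i λ′)) + 1

-- β-set: hook lengths h(i,1), 1 ≤ i ≤ r, of the first column
betaSet : List ℕ → List ℕ
betaSet λ′ = map (λ i → hook λ′ (suc i) 1) (upTo (length λ′))

_∈β_ : ℤ → List ℕ → Set
x ∈β λ′ = Σ ℕ (λ h → (h ∈ betaSet λ′) × (+ h ≡ x))

InGammaSet : (t p i : ℕ) .{{_ : NonZero p}} → ℤ → Set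
InGammaSet t p i x =
  Σ ℕ (λ k → (1 ≤ k) × (k ≤ ((i ∸ 1) / p) + 1) ×
     ((+ (k * t) ℤ.- (+ i ℤ.- (+ (k ∸ 1) ℤ.* + p)) ℤ.≤ x) × (x ℤ.≤ + (k * t) ℤ.- + 1)))

IsGamma : (t p i : ℕ) .{{_ : NonZero p}} → List ℕ → Set
IsGamma t p zero    γ = γ ≡ []
IsGamma t p (suc i) γ = IsPartition γ × ((x : ℤ) → (x ∈β γ) ⇔ InGammaSet t p (suc i) x)

module Submission where

-- Write n = pm + i with 1 ≤ i ≤ p.  The β-set of γ_n is a union of m + 1
-- disjoint intervals of lengths i, p + i, …, pm + i lying just below t, 2t,
-- …, (m+1)t.  Its decreasing enumeration 'blocks m' is built recursively:
-- passing to m + 1 shifts every interval up by t and adds a new lowest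
-- interval of width p(m+1) + i.  Since Σ β(λ) = |λ| + C(r, 2) for a partition
-- with r parts, this recursion gives |γ_{n+p}| = |γ_n| + r·(t - p(m+1) - i),
-- r the number of β-numbers of γ_{n+p}, and the closed form follows by
-- induction on m once the binomial coefficients of the statement are
-- related by Pascal's rule and 3·C(m+2,3) = m·C(m+2,2).  The case i = 0,
-- m ≥ 1 is the case i = p for m - 1, where both formulas agree.

open import Defs
open import Data.Nat using (ℕ; zero; suc; pred; _+_; _*_; _∸_; _≤_; _<_; _≤?_; z≤n; s≤s; s≤s⁻¹; NonZero)
open import Data.Nat.Properties
open import Data.Nat.Combinatorics using (_C_; nC1≡n; nCk+nC[k+1]≡[n+1]C[k+1])
open import Data.Nat.DivMod using (_/_; +-distrib-/-∣ˡ; m*n/n≡m; m<n⇒m/n≡0)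
open import Data.Nat.Divisibility using (divides)
open import Data.Nat.ListAction using (sum)
open import Data.Nat.ListAction.Properties using (sum-++)
import Data.Nat.Tactic.RingSolver as ℕ-Solver
open import Data.Integer as ℤ using (ℤ; +_)
import Data.Integer.Properties as ℤₚ
import Data.Integer.Tactic.RingSolver as ℤ-Solver
open import Data.List using (List; []; _∷_; length; map; upTo; applyUpTo; _++_)
open import Data.List.Properties using (map-applyUpTo; filter-all; length-map; length-applyUpTo; length-++)
open import Data.List.Relation.Unary.All as All using (All; []; _∷_)
import Data.List.Relation.Unary.All.Properties as Allₚ
open import Data.List.Relation.Unary.AllPairs as AllPairs using (AllPairs; []; _∷_)
import Data.List.Relation.Unary.AllPairs.Properties as AllPairsₚ
open import Data.List.Relation.Unary.Linked as Linked using (Linked; _∷_)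
open import Data.List.Relation.Unary.Any using (here; there)
open import Data.List.Membership.Propositional using (_∈_)
open import Data.List.Membership.Propositional.Properties using (∈-map⁺; ∈-map⁻; ∈-++⁺ˡ; ∈-++⁺ʳ; ∈-++⁻)
open import Data.Product using (Σ; _×_; _,_)
open import Data.Sum using (inj₁; inj₂)
open import Data.Empty using (⊥-elim)
open import Function using (id)
open import Function.Bundles using (_⇔_; mk⇔; Equivalence)
import Function.Properties.Equivalence as ⇔
open import Relation.Nullary using (yes; no)
open import Relation.Binary.PropositionalEquality
open ≡-Reasoning

C2-suc : ∀ n → suc n C 2 ≡ n + n C 2
C2-suc n = begin
  suc n C 2         ≡⟨ nCk+nC[k+1]≡[n+1]C[k+1] n 1 ⟨
  n C 1 + n C 2     ≡⟨ cong (_+ n C 2) (nC1≡n n) ⟩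
  n + n C 2         ∎

-- C(a+b, 2) splits into the pairs inside a, inside b, and across.
C2-+ : ∀ a b → (a + b) C 2 ≡ a C 2 + a * b + b C 2
C2-+ zero    b = refl
C2-+ (suc a) b = begin
  suc (a + b) C 2                   ≡⟨ C2-suc (a + b) ⟩
  a + b + (a + b) C 2               ≡⟨ cong (_+_ (a + b)) (C2-+ a b) ⟩
  a + b + (a C 2 + a * b + b C 2)   ≡⟨ rearrange a b (a C 2) (b C 2) ⟩
  (a + a C 2) + suc a * b + b C 2   ≡⟨ cong (λ x → x + suc a * b + b C 2) (C2-suc a) ⟨
  suc a C 2 + suc a * b + b C 2     ∎
  where
  rearrange : ∀ a b x y → a + b + (x + a * b + y) ≡ (a + x) + suc a * b + y
  rearrange = ℕ-Solver.solve-∀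

twice-C2 : ∀ m → 2 * ((m + 2) C 2) ≡ (m + 2) * (m + 1)
twice-C2 zero    = refl
twice-C2 (suc m) = begin
  2 * (suc (m + 2) C 2)             ≡⟨ cong (2 *_) (C2-suc (m + 2)) ⟩
  2 * (m + 2 + (m + 2) C 2)         ≡⟨ *-distribˡ-+ 2 (m + 2) ((m + 2) C 2) ⟩
  2 * (m + 2) + 2 * ((m + 2) C 2)   ≡⟨ cong (_+_ (2 * (m + 2))) (twice-C2 m) ⟩
  2 * (m + 2) + (m + 2) * (m + 1)   ≡⟨ expand m ⟩
  (suc m + 2) * (suc m + 1)         ∎
  where
  expand : ∀ m → 2 * (m + 2) + (m + 2) * (m + 1) ≡ (suc m + 2) * (suc m + 1)
  expand = ℕ-Solver.solve-∀

thrice-C3 : ∀ m → 3 * ((m + 2) C 3) ≡ m * ((m + 2) C 2)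
thrice-C3 zero    = refl
thrice-C3 (suc m) = begin
  3 * (suc (m + 2) C 3)         ≡⟨ cong (3 *_) (nCk+nC[k+1]≡[n+1]C[k+1] (m + 2) 2) ⟨
  3 * (a + (m + 2) C 3)         ≡⟨ *-distribˡ-+ 3 a ((m + 2) C 3) ⟩
  3 * a + 3 * ((m + 2) C 3)     ≡⟨ cong (_+_ (3 * a)) (thrice-C3 m) ⟩
  3 * a + m * a                 ≡⟨ regroup m a ⟩
  2 * a + suc m * a             ≡⟨ cong (_+ suc m * a) (twice-C2 m) ⟩
  (m + 2) * (m + 1) + suc m * a ≡⟨ expand m a ⟩
  suc m * (m + 2 + a)           ≡⟨ cong (suc m *_) (C2-suc (m + 2)) ⟨
  suc m * (suc (m + 2) C 2)     ∎
  where
  a = (m + 2) C 2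
  regroup : ∀ m a → 3 * a + m * a ≡ 2 * a + suc m * a
  regroup = ℕ-Solver.solve-∀
  expand : ∀ m a → (m + 2) * (m + 1) + suc m * a ≡ suc m * (m + 2 + a)
  expand = ℕ-Solver.solve-∀

Decreasing : List ℕ → Set
Decreasing = AllPairs (λ a b → b < a)

head-max : ∀ {a as x} → Decreasing (a ∷ as) → x ∈ a ∷ as → x ≤ a
head-max _          (here refl)  = ≤-refl
head-max (a>as ∷ _) (there x∈as) = <⇒≤ (All.lookup a>as x∈as)

decreasing-unique : ∀ {xs ys} → Decreasing xs → Decreasing ys →
                    (∀ x → x ∈ xs ⇔ x ∈ ys) → xs ≡ ys
decreasing-unique {[]}     {[]}     _ _ _ = refl
decreasing-unique {[]}     {y ∷ _}  _ _ same with Equivalence.from (same y) (here refl)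
... | ()
decreasing-unique {x ∷ _}  {[]}     _ _ same with Equivalence.to (same x) (here refl)
... | ()
decreasing-unique {x ∷ xs} {y ∷ ys} dx@(x>xs ∷ dxs) dy@(y>ys ∷ dys) same
  with ≤-antisym (head-max dy (Equivalence.to (same x) (here refl)))
                 (head-max dx (Equivalence.from (same y) (here refl)))
... | refl = cong (x ∷_) (decreasing-unique dxs dys (λ z → mk⇔ (to z) (from z)))
  where
  to : ∀ z → z ∈ xs → z ∈ ys
  to z z∈xs with Equivalence.to (same z) (there z∈xs)
  ... | here refl = ⊥-elim (<-irrefl refl (All.lookup x>xs z∈xs))
  ... | there z∈ys = z∈ys
  from : ∀ z → z ∈ ys → z ∈ xs
  from z z∈ys with Equivalence.from (same z) (there z∈ys)
  ... | here refl = ⊥-elim (<-irrefl refl (All.lookup y>ys z∈ys))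
  ... | there z∈xs = z∈xs

betaSet-cons : ∀ x xs → 1 ≤ x → All (1 ≤_) xs → betaSet (x ∷ xs) ≡ (x + length xs) ∷ betaSet xs
betaSet-cons (suc x) xs _ xs-pos = cong₂ _∷_ first-hook (begin
  map rowHook (applyUpTo suc r)   ≡⟨ map-applyUpTo suc rowHook r ⟩
  applyUpTo tailHook r            ≡⟨ map-applyUpTo id tailHook r ⟨
  map tailHook (upTo r)           ∎)
  where
  r = length xs
  rowHook tailHook : ℕ → ℕ
  rowHook i = hook (suc x ∷ xs) (suc i) 1
  tailHook i = hook xs (suc i) 1
  first-hook : rowHook 0 ≡ suc x + r
  first-hook rewrite filter-all (1 ≤?_) xs-pos = +-comm (x + r) 1

tail-partition : ∀ {x xs} → IsPartition (x ∷ xs) → IsPartition xs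
tail-partition (_ ∷ xs-pos , x≥xs) = xs-pos , Linked.tail x≥xs

betaSet-length : ∀ λ′ → length (betaSet λ′) ≡ length λ′
betaSet-length λ′ = trans (length-map _ (upTo (length λ′))) (length-applyUpTo id (length λ′))

betaSet-sum : ∀ λ′ → IsPartition λ′ → sum (betaSet λ′) ≡ size λ′ + length λ′ C 2
betaSet-sum []       _ = refl
betaSet-sum (x ∷ xs) part@(x-pos ∷ xs-pos , _) = begin
  sum (betaSet (x ∷ xs))                  ≡⟨ cong sum (betaSet-cons x xs x-pos xs-pos) ⟩
  x + r + sum (betaSet xs)                ≡⟨ cong (_+_ (x + r)) (betaSet-sum xs (tail-partition part)) ⟩
  x + r + (size xs + r C 2)               ≡⟨ regroup x r (size xs) (r C 2) ⟩
  x + size xs + (r + r C 2)               ≡⟨ cong (_+_ (x + size xs)) (C2-suc r) ⟨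
  x + size xs + suc r C 2                 ∎
  where
  r = length xs
  regroup : ∀ a b c d → a + b + (c + d) ≡ a + c + (b + d)
  regroup = ℕ-Solver.solve-∀

head-bounds : ∀ x xs → Linked (λ a b → b ≤ a) (x ∷ xs) → All (_≤ x) xs
head-bounds x []       _             = []
head-bounds x (y ∷ ys) (y≤x ∷ y≥ys) = y≤x ∷ All.map (λ z≤y → ≤-trans z≤y y≤x) (head-bounds y ys y≥ys)

betaSet-bounded : ∀ B λ′ → IsPartition λ′ → All (_≤ B) λ′ → All (_< B + length λ′) (betaSet λ′)
betaSet-bounded B []       _ _ = []
betaSet-bounded B (x ∷ xs) part@(x-pos ∷ xs-pos , _) (x≤B ∷ xs≤B)
  rewrite betaSet-cons x xs x-pos xs-pos | +-suc B (length xs) =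
  s≤s (+-monoˡ-≤ (length xs) x≤B)
  ∷ All.map (λ β<B+r → m≤n⇒m≤1+n β<B+r) (betaSet-bounded B xs (tail-partition part) xs≤B)

betaSet-decreasing : ∀ λ′ → IsPartition λ′ → Decreasing (betaSet λ′)
betaSet-decreasing []       _ = []
betaSet-decreasing (x ∷ xs) part@(x-pos ∷ xs-pos , x≥xs) rewrite betaSet-cons x xs x-pos xs-pos =
  betaSet-bounded x xs (tail-partition part) (head-bounds x xs x≥xs)
  ∷ betaSet-decreasing xs (tail-partition part)

run : ℕ → ℕ → List ℕ
run a zero    = []
run a (suc n) = a + n ∷ run a n

run-bounded : ∀ a n → All (_< a + n) (run a n)
run-bounded a zero    = []
run-bounded a (suc n) rewrite +-suc a n = n<1+n (a + n) ∷ All.map m<n⇒m<1+n (run-bounded a n)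

run-decreasing : ∀ a n → Decreasing (run a n)
run-decreasing a zero    = []
run-decreasing a (suc n) = run-bounded a n ∷ run-decreasing a n

∈-run : ∀ a n {x} → x ∈ run a n ⇔ (a ≤ x × x < a + n)
∈-run a n {x} = mk⇔ (to n) (from n)
  where
  to : ∀ n → x ∈ run a n → a ≤ x × x < a + n
  to (suc n) (here refl)  = m≤m+n a n , ≤-reflexive (sym (+-suc a n))
  to (suc n) (there x∈run) with to n x∈run
  ... | a≤x , x<a+n = a≤x , ≤-trans (m<n⇒m<1+n x<a+n) (≤-reflexive (sym (+-suc a n)))
  from : ∀ n → a ≤ x × x < a + n → x ∈ run a n
  from zero    (a≤x , x<a) = ⊥-elim (<-irrefl refl (<-≤-trans x<a (subst (_≤ x) (sym (+-identityʳ a)) a≤x)))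
  from (suc n) (a≤x , x<a+1+n) with x ≟ a + n
  ... | yes refl = here refl
  ... | no x≢a+n = there (from n (a≤x , ≤∧≢⇒< (s≤s⁻¹ (subst (x <_) (+-suc a n) x<a+1+n)) x≢a+n))

run-length : ∀ a n → length (run a n) ≡ n
run-length a zero    = refl
run-length a (suc n) = cong suc (run-length a n)

run-sum : ∀ a n → sum (run a n) ≡ n * a + n C 2
run-sum a zero    = refl
run-sum a (suc n) = begin
  a + n + sum (run a n)     ≡⟨ cong (_+_ (a + n)) (run-sum a n) ⟩
  a + n + (n * a + n C 2)   ≡⟨ regroup a n (n C 2) ⟩
  a + n * a + (n + n C 2)   ≡⟨ cong (_+_ (a + n * a)) (C2-suc n) ⟨
  suc n * a + suc n C 2     ∎
  where
  regroup : ∀ a n c → a + n + (n * a + c) ≡ a + n * a + (n + c)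
  regroup = ℕ-Solver.solve-∀

sum-shift : ∀ t xs → sum (map (_+_ t) xs) ≡ length xs * t + sum xs
sum-shift t []       = refl
sum-shift t (x ∷ xs) = begin
  t + x + sum (map (_+_ t) xs)        ≡⟨ cong (_+_ (t + x)) (sum-shift t xs) ⟩
  t + x + (length xs * t + sum xs)   ≡⟨ regroup t x (length xs) (sum xs) ⟩
  t + length xs * t + (x + sum xs)   ∎
  where
  regroup : ∀ t x n s → t + x + (n * t + s) ≡ t + n * t + (x + s)
  regroup = ℕ-Solver.solve-∀

-- The w largest naturals below t, described without truncated subtraction.
∈-below : ∀ t w {x} → w ≤ t → x ∈ run (t ∸ w) w ⇔ (t ≤ x + w × x < t)
∈-below t w {x} w≤t = mk⇔
  (λ x∈run → let (t-w≤x , x<t-w+w) = Equivalence.to (∈-run (t ∸ w) w) x∈run in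
    subst (_≤ x + w) t-w+w≡t (+-monoˡ-≤ w t-w≤x) , subst (x <_) t-w+w≡t x<t-w+w)
  (λ (t≤x+w , x<t) → Equivalence.from (∈-run (t ∸ w) w)
    (m≤n+o⇒m∸n≤o t w (subst (t ≤_) (+-comm x w) t≤x+w) , subst (x <_) (sym t-w+w≡t) x<t))
  where
  t-w+w≡t : t ∸ w + w ≡ t
  t-w+w≡t = m∸n+n≡m w≤t

-- The right-hand side of the theorem as a polynomial in t, p, i, m and the
-- binomial coefficients a = C(m+2,2), b = C(m+2,3), c = C(m+2,4).
Φ : (t p i m a b c : ℤ) → ℤ
Φ t p i m a b c =
  a ℤ.* (i ℤ.* t ℤ.- i ℤ.* p ℤ.* m ℤ.- i ℤ.* i)
  ℤ.+ b ℤ.* (p ℤ.* t ℤ.- p ℤ.* p)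
  ℤ.- + 3 ℤ.* c ℤ.* (p ℤ.* p)

Φ-cong : ∀ t p i {m a b c m′ a′ b′ c′} → m ≡ m′ → a ≡ a′ → b ≡ b′ → c ≡ c′ →
         Φ t p i m a b c ≡ Φ t p i m′ a′ b′ c′
Φ-cong t p i refl refl refl refl = refl

+-times-zero : ∀ x y z → x ℤ.+ y ℤ.* (z ℤ.- z) ≡ x
+-times-zero = ℤ-Solver.solve-∀

-- The ring solver does not unfold Φ, so the three identities below are
-- proved from copies with Φ written out.

Φ-base : ∀ t p i → i ℤ.* (t ℤ.- i) ≡ Φ t p i (+ 0) (+ 1) (+ 0) (+ 0)
Φ-base = expanded
  where
  expanded : ∀ t p i → i ℤ.* (t ℤ.- i)
    ≡ + 1 ℤ.* (i ℤ.* t ℤ.- i ℤ.* p ℤ.* + 0 ℤ.- i ℤ.* i) ℤ.+ + 0 ℤ.* (p ℤ.* t ℤ.- p ℤ.* p) ℤ.- + 3 ℤ.* + 0 ℤ.* (p ℤ.* p)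
  expanded = ℤ-Solver.solve-∀

-- Passing from m to m + 1 with Pascal's rule on a, b, c adds r·(t - n), where
-- r = (m+2)i + pa and n = p(m+1) + i, provided ma = 3b.
Φ-step : ∀ t p i m a b c → m ℤ.* a ≡ + 3 ℤ.* b →
         Φ t p i m a b c ℤ.+ ((m ℤ.+ + 2) ℤ.* i ℤ.+ p ℤ.* a) ℤ.* (t ℤ.- (p ℤ.* (m ℤ.+ + 1) ℤ.+ i))
         ≡ Φ t p i (m ℤ.+ + 1) ((m ℤ.+ + 2) ℤ.+ a) (a ℤ.+ b) (b ℤ.+ c)
Φ-step t p i m a b c ma≡3b = begin
  Φ t p i m a b c ℤ.+ ((m ℤ.+ + 2) ℤ.* i ℤ.+ p ℤ.* a) ℤ.* (t ℤ.- (p ℤ.* (m ℤ.+ + 1) ℤ.+ i))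
    ≡⟨ expanded t p i m a b c ⟩
  Φ′ ℤ.+ p ℤ.* p ℤ.* (+ 3 ℤ.* b ℤ.- m ℤ.* a)
    ≡⟨ cong (λ u → Φ′ ℤ.+ p ℤ.* p ℤ.* (u ℤ.- m ℤ.* a)) ma≡3b ⟨
  Φ′ ℤ.+ p ℤ.* p ℤ.* (m ℤ.* a ℤ.- m ℤ.* a)
    ≡⟨ +-times-zero Φ′ (p ℤ.* p) (m ℤ.* a) ⟩
  Φ′ ∎
  where
  Φ′ = Φ t p i (m ℤ.+ + 1) ((m ℤ.+ + 2) ℤ.+ a) (a ℤ.+ b) (b ℤ.+ c)
  expanded : ∀ t p i m a b c →
    a ℤ.* (i ℤ.* t ℤ.- i ℤ.* p ℤ.* m ℤ.- i ℤ.* i) ℤ.+ b ℤ.* (p ℤ.* t ℤ.- p ℤ.* p) ℤ.- + 3 ℤ.* c ℤ.* (p ℤ.* p)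
      ℤ.+ ((m ℤ.+ + 2) ℤ.* i ℤ.+ p ℤ.* a) ℤ.* (t ℤ.- (p ℤ.* (m ℤ.+ + 1) ℤ.+ i))
    ≡ (m ℤ.+ + 2 ℤ.+ a) ℤ.* (i ℤ.* t ℤ.- i ℤ.* p ℤ.* (m ℤ.+ + 1) ℤ.- i ℤ.* i) ℤ.+ (a ℤ.+ b) ℤ.* (p ℤ.* t ℤ.- p ℤ.* p)
      ℤ.- + 3 ℤ.* (b ℤ.+ c) ℤ.* (p ℤ.* p) ℤ.+ p ℤ.* p ℤ.* (+ 3 ℤ.* b ℤ.- m ℤ.* a)
  expanded = ℤ-Solver.solve-∀

-- The formula at remainder 0 and quotient m + 1 equals the one at remainder p
-- and quotient m, provided ma = 3b: both describe p(m+1) = pm + p.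
Φ-wrap : ∀ t p m a b c → m ℤ.* a ≡ + 3 ℤ.* b →
         Φ t p (+ 0) (m ℤ.+ + 1) ((m ℤ.+ + 2) ℤ.+ a) (a ℤ.+ b) (b ℤ.+ c) ≡ Φ t p p m a b c
Φ-wrap t p m a b c ma≡3b = begin
  Φ t p (+ 0) (m ℤ.+ + 1) ((m ℤ.+ + 2) ℤ.+ a) (a ℤ.+ b) (b ℤ.+ c)
    ≡⟨ expanded t p m a b c ⟩
  Φ t p p m a b c ℤ.+ p ℤ.* p ℤ.* (m ℤ.* a ℤ.- + 3 ℤ.* b)
    ≡⟨ cong (λ u → Φ t p p m a b c ℤ.+ p ℤ.* p ℤ.* (m ℤ.* a ℤ.- u)) ma≡3b ⟨
  Φ t p p m a b c ℤ.+ p ℤ.* p ℤ.* (m ℤ.* a ℤ.- m ℤ.* a)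
    ≡⟨ +-times-zero (Φ t p p m a b c) (p ℤ.* p) (m ℤ.* a) ⟩
  Φ t p p m a b c ∎
  where
  expanded : ∀ t p m a b c →
    (m ℤ.+ + 2 ℤ.+ a) ℤ.* (+ 0 ℤ.* t ℤ.- + 0 ℤ.* p ℤ.* (m ℤ.+ + 1) ℤ.- + 0 ℤ.* + 0) ℤ.+ (a ℤ.+ b) ℤ.* (p ℤ.* t ℤ.- p ℤ.* p)
      ℤ.- + 3 ℤ.* (b ℤ.+ c) ℤ.* (p ℤ.* p)
    ≡ a ℤ.* (p ℤ.* t ℤ.- p ℤ.* p ℤ.* m ℤ.- p ℤ.* p) ℤ.+ b ℤ.* (p ℤ.* t ℤ.- p ℤ.* p) ℤ.- + 3 ℤ.* c ℤ.* (p ℤ.* p)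
      ℤ.+ p ℤ.* p ℤ.* (m ℤ.* a ℤ.- + 3 ℤ.* b)
  expanded = ℤ-Solver.solve-∀

pos-∸ : ∀ {a b} → b ≤ a → + (a ∸ b) ≡ + a ℤ.- + b
pos-∸ {a} {b} b≤a = sym (trans (ℤₚ.m-n≡m⊖n a b) (ℤₚ.⊖-≥ b≤a))

pos-suc : ∀ m → + suc m ≡ + m ℤ.+ + 1
pos-suc m = trans (cong +_ (+-comm 1 m)) (ℤₚ.pos-+ m 1)

closedForm : (t p i m : ℕ) → ℤ
closedForm t p i m = Φ (+ t) (+ p) (+ i) (+ m) (+ ((m + 2) C 2)) (+ ((m + 2) C 3)) (+ ((m + 2) C 4))

closedForm-pascal : ∀ t p i m → let a = (m + 2) C 2; b = (m + 2) C 3; c = (m + 2) C 4 in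
  closedForm t p i (suc m) ≡ Φ (+ t) (+ p) (+ i) (+ m ℤ.+ + 1) ((+ m ℤ.+ + 2) ℤ.+ + a) (+ a ℤ.+ + b) (+ b ℤ.+ + c)
closedForm-pascal t p i m = Φ-cong (+ t) (+ p) (+ i) (pos-suc m)
  (trans (cong +_ (C2-suc (m + 2))) (trans (ℤₚ.pos-+ (m + 2) a) (cong (ℤ._+ + a) (ℤₚ.pos-+ m 2))))
  (trans (cong +_ (sym (nCk+nC[k+1]≡[n+1]C[k+1] (m + 2) 2))) (ℤₚ.pos-+ a b))
  (trans (cong +_ (sym (nCk+nC[k+1]≡[n+1]C[k+1] (m + 2) 3))) (ℤₚ.pos-+ b c))
  where
  a = (m + 2) C 2
  b = (m + 2) C 3
  c = (m + 2) C 4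

closedForm-ratio : ∀ m → + m ℤ.* + ((m + 2) C 2) ≡ + 3 ℤ.* + ((m + 2) C 3)
closedForm-ratio m =
  trans (sym (ℤₚ.pos-* m ((m + 2) C 2))) (trans (cong +_ (sym (thrice-C3 m))) (ℤₚ.pos-* 3 ((m + 2) C 3)))

closedForm-suc : ∀ t p i m →
  closedForm t p i m
    ℤ.+ ((+ m ℤ.+ + 2) ℤ.* + i ℤ.+ + p ℤ.* + ((m + 2) C 2)) ℤ.* (+ t ℤ.- (+ p ℤ.* (+ m ℤ.+ + 1) ℤ.+ + i))
  ≡ closedForm t p i (suc m)
closedForm-suc t p i m =
  trans (Φ-step (+ t) (+ p) (+ i) (+ m) (+ ((m + 2) C 2)) (+ ((m + 2) C 3)) (+ ((m + 2) C 4)) (closedForm-ratio m))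
        (sym (closedForm-pascal t p i m))

closedForm-wrap : ∀ t p m → closedForm t p 0 (suc m) ≡ closedForm t p p m
closedForm-wrap t p m =
  trans (closedForm-pascal t p 0 m)
        (Φ-wrap (+ t) (+ p) (+ m) (+ ((m + 2) C 2)) (+ ((m + 2) C 3)) (+ ((m + 2) C 4)) (closedForm-ratio m))

module Blocks (t p i : ℕ) where

  -- The longest interval in β(γ_{pm+i}) has pm + i elements.
  width : ℕ → ℕ
  width m = p * m + i

  width-mono : ∀ m → width m ≤ width (suc m)
  width-mono m = +-monoˡ-≤ i (*-monoʳ-≤ p (n≤1+n m))

  top : ℕ → List ℕ
  top w = run (t ∸ w) w

  -- The decreasing enumeration of β(γ_{pm+i}): passing from m to m + 1 shifts
  -- every interval up by t and adds a new lowest interval of width pm + p + i.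
  blocks : ℕ → List ℕ
  blocks zero    = top (width 0)
  blocks (suc m) = map (_+_ t) (blocks m) ++ top (width (suc m))

  -- x lies in the (k+1)-st interval [(k+1)t - (width m - kp), (k+1)t - 1].
  InBlock : ℕ → ℕ → ℕ → Set
  InBlock m k x = k * p + suc k * t ≤ x + width m × x < suc k * t

  -- The union of the m + 1 intervals: this is β(γ_{pm+i}) (InGammaSet⇔InBlocks).
  InBlocks : ℕ → ℕ → Set
  InBlocks m x = Σ ℕ λ k → k ≤ m × InBlock m k x

  ∈-top : ∀ m {x} → width m ≤ t → x ∈ top (width m) ⇔ InBlock m 0 x
  ∈-top m w≤t rewrite +-identityʳ t = ∈-below t (width m) w≤t

  InBlock-shift : ∀ m k y → InBlock (suc m) (suc k) (t + y) ⇔ InBlock m k y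
  InBlock-shift m k y = mk⇔
    (λ (lo , hi) → +-cancelˡ-≤ (p + t) _ _ (subst₂ _≤_ lower≡ upper≡ lo) , +-cancelˡ-< t y (suc k * t) hi)
    (λ (lo , hi) → subst₂ _≤_ (sym lower≡) (sym upper≡) (+-monoʳ-≤ (p + t) lo) , +-monoʳ-< t hi)
    where
    lower≡ : suc k * p + suc (suc k) * t ≡ (p + t) + (k * p + suc k * t)
    lower≡ = identity p t k
      where
      identity : ∀ p t k → suc k * p + suc (suc k) * t ≡ (p + t) + (k * p + suc k * t)
      identity = ℕ-Solver.solve-∀
    upper≡ : t + y + width (suc m) ≡ (p + t) + (y + width m)
    upper≡ = identity t y p m i
      where
      identity : ∀ t y p m i → t + y + (p * suc m + i) ≡ (p + t) + (y + (p * m + i))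
      identity = ℕ-Solver.solve-∀

  InBlock-above : ∀ m k {x} → width m ≤ t → InBlock m (suc k) x → t ≤ x
  InBlock-above m k {x} w≤t (lo , _) = +-cancelʳ-≤ t t x (≤-trans t+t≤lower (≤-trans lo (+-monoʳ-≤ x w≤t)))
    where
    t+t≤lower : t + t ≤ suc k * p + suc (suc k) * t
    t+t≤lower = ≤-trans (+-monoʳ-≤ t (m≤m+n t (k * t))) (m≤n+m _ (suc k * p))

  -- blocks m enumerates exactly the union of the intervals ...
  blocks-sound : ∀ m {x} → width m ≤ t → x ∈ blocks m → InBlocks m x
  blocks-sound zero    w≤t x∈top = 0 , z≤n , Equivalence.to (∈-top 0 w≤t) x∈top
  blocks-sound (suc m) w≤t x∈blocks with ∈-++⁻ (map (_+_ t) (blocks m)) x∈blocks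
  ... | inj₂ x∈top = 0 , z≤n , Equivalence.to (∈-top (suc m) w≤t) x∈top
  ... | inj₁ x∈shifted with ∈-map⁻ (_+_ t) x∈shifted
  ... | y , y∈blocks , refl with blocks-sound m (≤-trans (width-mono m) w≤t) y∈blocks
  ... | k , k≤m , y∈block = suc k , s≤s k≤m , Equivalence.from (InBlock-shift m k y) y∈block

  blocks-complete : ∀ m {x} → width m ≤ t → InBlocks m x → x ∈ blocks m
  blocks-complete zero    w≤t (zero , _ , x∈block) = Equivalence.from (∈-top 0 w≤t) x∈block
  blocks-complete (suc m) w≤t (zero , _ , x∈block) =
    ∈-++⁺ʳ (map (_+_ t) (blocks m)) (Equivalence.from (∈-top (suc m) w≤t) x∈block)
  blocks-complete (suc m) {x} w≤t (suc k , s≤s k≤m , x∈block) =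
    subst (_∈ blocks (suc m)) t+y≡x (∈-++⁺ˡ (∈-map⁺ (_+_ t)
      (blocks-complete m (≤-trans (width-mono m) w≤t) (k , k≤m ,
        Equivalence.to (InBlock-shift m k y) (subst (InBlock (suc m) (suc k)) (sym t+y≡x) x∈block)))))
    where
    y = x ∸ t
    t+y≡x : t + y ≡ x
    t+y≡x = m+[n∸m]≡n (InBlock-above (suc m) k w≤t x∈block)

  -- ... in strictly decreasing order: shifted intervals lie above t, the new one below.
  blocks-decreasing : ∀ m → width m ≤ t → Decreasing (blocks m)
  blocks-decreasing zero    _   = run-decreasing (t ∸ width 0) (width 0)
  blocks-decreasing (suc m) w≤t =
    AllPairsₚ.++⁺ (AllPairsₚ.map⁺ (AllPairs.map (+-monoʳ-< t) (blocks-decreasing m (≤-trans (width-mono m) w≤t))))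
                  (run-decreasing (t ∸ w) w)
                  (Allₚ.map⁺ (All.universal (λ y → All.map (λ z<t → <-≤-trans z<t (m≤m+n t y)) top<t) (blocks m)))
    where
    w = width (suc m)
    top<t : All (_< t) (top w)
    top<t = subst (λ u → All (_< u) (top w)) (m∸n+n≡m w≤t) (run-bounded (t ∸ w) w)

  blocks-length-step : ∀ m → length (blocks (suc m)) ≡ length (blocks m) + width (suc m)
  blocks-length-step m = trans (length-++ (map (_+_ t) (blocks m)))
    (cong₂ _+_ (length-map (_+_ t) (blocks m)) (run-length (t ∸ width (suc m)) (width (suc m))))

  blocks-length : ∀ m → length (blocks (suc m)) ≡ (m + 2) * i + p * ((m + 2) C 2)
  blocks-length zero    = begin
    length (blocks 1)             ≡⟨ blocks-length-step 0 ⟩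
    length (blocks 0) + width 1   ≡⟨ cong (_+ width 1) (run-length (t ∸ width 0) (width 0)) ⟩
    width 0 + width 1             ≡⟨ identity p i ⟩
    2 * i + p * 1                 ∎
    where
    identity : ∀ p i → p * 0 + i + (p * 1 + i) ≡ 2 * i + p * 1
    identity = ℕ-Solver.solve-∀
  blocks-length (suc m) = begin
    length (blocks (suc (suc m)))                         ≡⟨ blocks-length-step (suc m) ⟩
    length (blocks (suc m)) + width (suc (suc m))         ≡⟨ cong (_+ width (suc (suc m))) (blocks-length m) ⟩
    (m + 2) * i + p * a + width (suc (suc m))             ≡⟨ identity m i p a ⟩
    (suc m + 2) * i + p * (m + 2 + a)                     ≡⟨ cong (λ c → (suc m + 2) * i + p * c) (C2-suc (m + 2)) ⟨
    (suc m + 2) * i + p * ((suc m + 2) C 2)               ∎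
    where
    a = (m + 2) C 2
    identity : ∀ m i p a → (m + 2) * i + p * a + (p * suc (suc m) + i) ≡ (suc m + 2) * i + p * (m + 2 + a)
    identity = ℕ-Solver.solve-∀

  -- The size f(m) of γ_{pm+i}, by the recursion f(m+1) = f(m) + r·(t - width(m+1)),
  -- where r is the number of β-numbers of γ_{p(m+1)+i}.
  gammaSize : ℕ → ℕ
  gammaSize zero    = width 0 * (t ∸ width 0)
  gammaSize (suc m) = gammaSize m + length (blocks (suc m)) * (t ∸ width (suc m))

  -- Σ β = |γ| + C(r, 2): gammaSize is the size of the partition whose β-set is blocks m.
  blocks-sum : ∀ m → width m ≤ t → sum (blocks m) ≡ gammaSize m + length (blocks m) C 2
  blocks-sum zero _ rewrite run-length (t ∸ width 0) (width 0) = run-sum (t ∸ width 0) (width 0)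
  blocks-sum (suc m) w≤t = begin
    sum (map (_+_ t) (blocks m) ++ top w)
      ≡⟨ sum-++ (map (_+_ t) (blocks m)) (top w) ⟩
    sum (map (_+_ t) (blocks m)) + sum (top w)
      ≡⟨ cong₂ _+_ (sum-shift t (blocks m)) (run-sum d w) ⟩
    r * t + sum (blocks m) + (w * d + w C 2)
      ≡⟨ cong (λ s → r * t + s + (w * d + w C 2)) (blocks-sum m (≤-trans (width-mono m) w≤t)) ⟩
    r * t + (gammaSize m + r C 2) + (w * d + w C 2)
      ≡⟨ cong (λ u → r * u + (gammaSize m + r C 2) + (w * d + w C 2)) (m∸n+n≡m w≤t) ⟨
    r * (d + w) + (gammaSize m + r C 2) + (w * d + w C 2)
      ≡⟨ regroup r d w (gammaSize m) (r C 2) (w C 2) ⟩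
    gammaSize m + (r + w) * d + (r C 2 + r * w + w C 2)
      ≡⟨ cong (_+_ (gammaSize m + (r + w) * d)) (C2-+ r w) ⟨
    gammaSize m + (r + w) * d + (r + w) C 2
      ≡⟨ cong (λ r′ → gammaSize m + r′ * d + r′ C 2) (blocks-length-step m) ⟨
    gammaSize (suc m) + length (blocks (suc m)) C 2 ∎
    where
    r = length (blocks m)
    w = width (suc m)
    d = t ∸ w
    regroup : ∀ r d w g x y → r * (d + w) + (g + x) + (w * d + y) ≡ g + (r + w) * d + (x + r * w + y)
    regroup = ℕ-Solver.solve-∀

  gammaSize-correct : ∀ m (γ : List ℕ) → width m ≤ t → IsPartition γ →
                      (∀ x → x ∈ betaSet γ ⇔ InBlocks m x) → size γ ≡ gammaSize m
  gammaSize-correct m γ w≤t γ-partition β≡blocks = +-cancelʳ-≡ (r C 2) (size γ) (gammaSize m) (begin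
    size γ + r C 2                        ≡⟨ betaSet-sum γ γ-partition ⟨
    sum (betaSet γ)                       ≡⟨ cong sum betaSet≡blocks ⟩
    sum (blocks m)                        ≡⟨ blocks-sum m w≤t ⟩
    gammaSize m + length (blocks m) C 2   ≡⟨ cong (λ n → gammaSize m + n C 2) length≡ ⟩
    gammaSize m + r C 2                   ∎)
    where
    r = length γ
    betaSet≡blocks : betaSet γ ≡ blocks m
    betaSet≡blocks = decreasing-unique (betaSet-decreasing γ γ-partition) (blocks-decreasing m w≤t)
      (λ x → mk⇔ (λ x∈β → blocks-complete m w≤t (Equivalence.to (β≡blocks x) x∈β))
                 (λ x∈blocks → Equivalence.from (β≡blocks x) (blocks-sound m w≤t x∈blocks)))
    length≡ : length (blocks m) ≡ r
    length≡ = trans (cong length (sym betaSet≡blocks)) (betaSet-length γ)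

  gammaSize-closed : ∀ m → width m ≤ t → + gammaSize m ≡ closedForm t p i m
  gammaSize-closed zero w≤t = begin
    + (width 0 * (t ∸ width 0))   ≡⟨ cong (λ w → + (w * (t ∸ w))) width0≡i ⟩
    + (i * (t ∸ i))               ≡⟨ ℤₚ.pos-* i (t ∸ i) ⟩
    + i ℤ.* + (t ∸ i)             ≡⟨ cong (ℤ._*_ (+ i)) (pos-∸ (subst (_≤ t) width0≡i w≤t)) ⟩
    + i ℤ.* (+ t ℤ.- + i)         ≡⟨ Φ-base (+ t) (+ p) (+ i) ⟩
    closedForm t p i 0            ∎
    where
    width0≡i : width 0 ≡ i
    width0≡i = cong (_+ i) (*-zeroʳ p)
  gammaSize-closed (suc m) w≤t = begin
    + (gammaSize m + r * (t ∸ w))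
      ≡⟨ ℤₚ.pos-+ (gammaSize m) (r * (t ∸ w)) ⟩
    + gammaSize m ℤ.+ + (r * (t ∸ w))
      ≡⟨ cong₂ ℤ._+_ (gammaSize-closed m (≤-trans (width-mono m) w≤t)) (ℤₚ.pos-* r (t ∸ w)) ⟩
    closedForm t p i m ℤ.+ + r ℤ.* + (t ∸ w)
      ≡⟨ cong₂ (λ x y → closedForm t p i m ℤ.+ x ℤ.* y) r≡ (trans (pos-∸ w≤t) (cong (ℤ._-_ (+ t)) w≡)) ⟩
    closedForm t p i m ℤ.+ ((+ m ℤ.+ + 2) ℤ.* + i ℤ.+ + p ℤ.* + a) ℤ.* (+ t ℤ.- (+ p ℤ.* (+ m ℤ.+ + 1) ℤ.+ + i))
      ≡⟨ closedForm-suc t p i m ⟩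
    closedForm t p i (suc m) ∎
    where
    a = (m + 2) C 2
    r = length (blocks (suc m))
    w = width (suc m)
    r≡ : + r ≡ (+ m ℤ.+ + 2) ℤ.* + i ℤ.+ + p ℤ.* + a
    r≡ = begin
      + r                                  ≡⟨ cong +_ (blocks-length m) ⟩
      + ((m + 2) * i + p * a)              ≡⟨ ℤₚ.pos-+ ((m + 2) * i) (p * a) ⟩
      + ((m + 2) * i) ℤ.+ + (p * a)        ≡⟨ cong₂ ℤ._+_ (trans (ℤₚ.pos-* (m + 2) i) (cong (ℤ._* + i) (ℤₚ.pos-+ m 2)))
                                                        (ℤₚ.pos-* p a) ⟩
      (+ m ℤ.+ + 2) ℤ.* + i ℤ.+ + p ℤ.* + a ∎
    w≡ : + w ≡ + p ℤ.* (+ m ℤ.+ + 1) ℤ.+ + i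
    w≡ = trans (ℤₚ.pos-+ (p * suc m) i) (cong (ℤ._+ + i) (trans (ℤₚ.pos-* p (suc m)) (cong (ℤ._*_ (+ p)) (pos-suc m))))

sub-≤⇔ : ∀ i j k → (i ℤ.- j ℤ.≤ k) ⇔ (i ℤ.≤ k ℤ.+ j)
sub-≤⇔ i j k = mk⇔
  (λ i-j≤k → subst (ℤ._≤ k ℤ.+ j) (minus-plus i j) (ℤₚ.+-monoˡ-≤ j i-j≤k))
  (λ i≤k+j → subst (i ℤ.- j ℤ.≤_) (plus-minus k j) (ℤₚ.+-monoˡ-≤ (ℤ.- j) i≤k+j))
  where
  minus-plus : ∀ x y → x ℤ.- y ℤ.+ y ≡ x
  minus-plus = ℤ-Solver.solve-∀
  plus-minus : ∀ x y → x ℤ.+ y ℤ.- y ≡ x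
  plus-minus = ℤ-Solver.solve-∀

≤-sub⇔ : ∀ i j k → (k ℤ.≤ i ℤ.- j) ⇔ (k ℤ.+ j ℤ.≤ i)
≤-sub⇔ i j k = mk⇔
  (λ k≤i-j → subst (k ℤ.+ j ℤ.≤_) (minus-plus i j) (ℤₚ.+-monoˡ-≤ j k≤i-j))
  (λ k+j≤i → subst (ℤ._≤ i ℤ.- j) (plus-minus k j) (ℤₚ.+-monoˡ-≤ (ℤ.- j) k+j≤i))
  where
  minus-plus : ∀ x y → x ℤ.- y ℤ.+ y ≡ x
  minus-plus = ℤ-Solver.solve-∀
  plus-minus : ∀ x y → x ℤ.+ y ℤ.- y ≡ x
  plus-minus = ℤ-Solver.solve-∀

pos-sub-≤⇔ : ∀ u n x → (+ u ℤ.- + n ℤ.≤ + x) ⇔ (u ≤ x + n)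
pos-sub-≤⇔ u n x = mk⇔
  (λ u-n≤x → ℤₚ.drop‿+≤+ (subst (+ u ℤ.≤_) (sym (ℤₚ.pos-+ x n))
                                  (Equivalence.to (sub-≤⇔ (+ u) (+ n) (+ x)) u-n≤x)))
  (λ u≤x+n → Equivalence.from (sub-≤⇔ (+ u) (+ n) (+ x)) (subst (+ u ℤ.≤_) (ℤₚ.pos-+ x n) (ℤ.+≤+ u≤x+n)))

pos-≤-sub⇔ : ∀ a j x → (+ x ℤ.≤ + a ℤ.- + j) ⇔ (x + j ≤ a)
pos-≤-sub⇔ a j x = mk⇔
  (λ x≤a-j → ℤₚ.drop‿+≤+ (subst (ℤ._≤ + a) (sym (ℤₚ.pos-+ x j))
                                  (Equivalence.to (≤-sub⇔ (+ a) (+ j) (+ x)) x≤a-j)))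
  (λ x+j≤a → Equivalence.from (≤-sub⇔ (+ a) (+ j) (+ x)) (subst (ℤ._≤ + a) (ℤₚ.pos-+ x j) (ℤ.+≤+ x+j≤a)))

-- The lower end kt - (n - (k-1)p) of an interval of InGammaSet (here k-1 is written k).
lower-bound⇔ : ∀ a n k p x → (+ a ℤ.- (+ n ℤ.- + k ℤ.* + p) ℤ.≤ + x) ⇔ (k * p + a ≤ x + n)
lower-bound⇔ a n k p x = subst (λ l → (l ℤ.≤ + x) ⇔ (k * p + a ≤ x + n)) (sym lhs≡) (pos-sub-≤⇔ (k * p + a) n x)
  where
  regroup : ∀ a n kp → a ℤ.- (n ℤ.- kp) ≡ kp ℤ.+ a ℤ.- n
  regroup = ℤ-Solver.solve-∀
  lhs≡ : + a ℤ.- (+ n ℤ.- + k ℤ.* + p) ≡ + (k * p + a) ℤ.- + n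
  lhs≡ = trans (regroup (+ a) (+ n) (+ k ℤ.* + p))
    (cong (ℤ._- + n) (sym (trans (ℤₚ.pos-+ (k * p) a) (cong (ℤ._+ + a) (ℤₚ.pos-* k p)))))

upper-bound⇔ : ∀ a x → (+ x ℤ.≤ + a ℤ.- + 1) ⇔ (x < a)
upper-bound⇔ a x = subst (λ y → (+ x ℤ.≤ + a ℤ.- + 1) ⇔ (y ≤ a)) (+-comm x 1) (pos-≤-sub⇔ a 1 x)

quotient : ∀ p m r .{{_ : NonZero p}} → r < p → (p * m + r) / p ≡ m
quotient p m r r<p = begin
  (p * m + r) / p      ≡⟨ +-distrib-/-∣ˡ r (divides m (*-comm p m)) ⟩
  p * m / p + r / p    ≡⟨ cong₂ _+_ (trans (cong (_/ p) (*-comm p m)) (m*n/n≡m m p)) (m<n⇒m/n≡0 r<p) ⟩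
  m + 0                ≡⟨ +-identityʳ m ⟩
  m                    ∎

-- For n = pm + r with r < p, the set of the statement is the union of the
-- intervals of Blocks with i = r + 1; the bound ⌊n/p⌋ + 1 on k is m + 1.
InGammaSet⇔InBlocks : ∀ t p r m .{{_ : NonZero p}} → r < p → ∀ x →
                      InGammaSet t p (suc (p * m + r)) (+ x) ⇔ Blocks.InBlocks t p (suc r) m x
InGammaSet⇔InBlocks t p r m r<p x = mk⇔
  (λ { (suc k , _ , k<m+1 , lo , hi) →
         k , s≤s⁻¹ (subst (suc k ≤_) bound≡ k<m+1) ,
         subst (k * p + suc k * t ≤_) width≡ (Equivalence.to (lower-bound⇔ (suc k * t) (suc n) k p x) lo) ,
         Equivalence.to (upper-bound⇔ (suc k * t) x) hi })
  (λ { (k , k≤m , lo , hi) →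
         suc k , s≤s z≤n , subst (suc k ≤_) (sym bound≡) (s≤s k≤m) ,
         Equivalence.from (lower-bound⇔ (suc k * t) (suc n) k p x) (subst (k * p + suc k * t ≤_) (sym width≡) lo) ,
         Equivalence.from (upper-bound⇔ (suc k * t) x) hi })
  where
  n = p * m + r
  bound≡ : n / p + 1 ≡ suc m
  bound≡ = trans (cong (_+ 1) (quotient p m r r<p)) (+-comm m 1)
  width≡ : x + suc n ≡ x + Blocks.width t p (suc r) m
  width≡ = cong (_+_ x) (sym (+-suc (p * m) r))

∈betaSet⇔∈β : ∀ γ x → (x ∈ betaSet γ) ⇔ ((+ x) ∈β γ)
∈betaSet⇔∈β γ x = mk⇔ (λ x∈β → x , x∈β , refl)
  (λ { (h , h∈β , +h≡+x) → subst (_∈ betaSet γ) (ℤₚ.+-injective +h≡+x) h∈β })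

-- The case 1 ≤ i ≤ p, written i = r + 1 with r < p.
size-formula : ∀ t p r m .{{_ : NonZero p}} → r < p → p * m + suc r ≤ t → (γ : List ℕ) →
               IsGamma t p (suc (p * m + r)) γ → + size γ ≡ closedForm t p (suc r) m
size-formula t p r m r<p w≤t γ (γ-partition , β-spec) = begin
  + size γ        ≡⟨ cong +_ (gammaSize-correct m γ w≤t γ-partition β≡blocks) ⟩
  + gammaSize m   ≡⟨ gammaSize-closed m w≤t ⟩
  closedForm t p (suc r) m ∎
  where
  open Blocks t p (suc r)
  β≡blocks : ∀ x → x ∈ betaSet γ ⇔ InBlocks m x
  β≡blocks x = ⇔.trans (∈betaSet⇔∈β γ x) (⇔.trans (β-spec (+ x)) (InGammaSet⇔InBlocks t p r m r<p x))

statement-rhs : ∀ t p i m →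
    (+ ((m + 2) C 2)) ℤ.* (+ (i * t) ℤ.- + (i * p * m) ℤ.- + (i * i))
    ℤ.+ (+ ((m + 2) C 3)) ℤ.* (+ (p * t) ℤ.- + (p * p))
    ℤ.- + 3 ℤ.* (+ ((m + 2) C 4)) ℤ.* + (p * p)
  ≡ closedForm t p i m
statement-rhs t p i m =
  push (ℤₚ.pos-* i t) (trans (ℤₚ.pos-* (i * p) m) (cong (ℤ._* + m) (ℤₚ.pos-* i p)))
       (ℤₚ.pos-* i i) (ℤₚ.pos-* p t) (ℤₚ.pos-* p p)
  where
  a = + ((m + 2) C 2)
  b = + ((m + 2) C 3)
  c = + ((m + 2) C 4)
  push : ∀ {it ipm ii pt pp it′ ipm′ ii′ pt′ pp′} →
         it ≡ it′ → ipm ≡ ipm′ → ii ≡ ii′ → pt ≡ pt′ → pp ≡ pp′ →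
         a ℤ.* (it ℤ.- ipm ℤ.- ii) ℤ.+ b ℤ.* (pt ℤ.- pp) ℤ.- + 3 ℤ.* c ℤ.* pp
         ≡ a ℤ.* (it′ ℤ.- ipm′ ℤ.- ii′) ℤ.+ b ℤ.* (pt′ ℤ.- pp′) ℤ.- + 3 ℤ.* c ℤ.* pp′
  push refl refl refl refl refl = refl

lemma3p5 : (t p : ℕ) → 1 ≤ t → .{{_ : NonZero p}} → (i m : ℕ) → i ≤ p → p * m + i < t →
    (γ : List ℕ) → IsGamma t p (p * m + i) γ →
    + size γ ≡
      (+ ((m + 2) C 2)) ℤ.* (+ (i * t) ℤ.- + (i * p * m) ℤ.- + (i * i))
      ℤ.+ (+ ((m + 2) C 3)) ℤ.* (+ (p * t) ℤ.- + (p * p))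
      ℤ.- + 3 ℤ.* (+ ((m + 2) C 4)) ℤ.* + (p * p)
-- 1 ≤ i ≤ p: the general case.
lemma3p5 t p _ (suc r) m r<p n<t γ γ-spec = begin
  + size γ                  ≡⟨ size-formula t p r m r<p (<⇒≤ n<t) γ
                                 (subst (λ n → IsGamma t p n γ) (+-suc (p * m) r) γ-spec) ⟩
  closedForm t p (suc r) m  ≡⟨ statement-rhs t p (suc r) m ⟨
  _                         ∎
lemma3p5 t p _ zero zero _ _ γ γ-spec with subst (λ n → IsGamma t p n γ) (cong (_+ 0) (*-zeroʳ p)) γ-spec
... | refl = refl
-- i = 0 < m: write p(m′+1) = pm′ + p and use the case i = p.
lemma3p5 t p _ zero (suc m′) _ n<t γ γ-spec = begin
  + size γ                  ≡⟨ size-formula t p (pred p) m′ pred-p<p (subst (_≤ t) n≡ (<⇒≤ n<t)) γ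
                                 (subst (λ n → IsGamma t p n γ) (trans n≡ (+-suc (p * m′) (pred p))) γ-spec) ⟩
  closedForm t p (suc (pred p)) m′ ≡⟨ cong (λ i → closedForm t p i m′) (suc-pred p) ⟩
  closedForm t p p m′       ≡⟨ closedForm-wrap t p m′ ⟨
  closedForm t p 0 (suc m′) ≡⟨ statement-rhs t p 0 (suc m′) ⟨
  _                         ∎
  where
  pred-p<p : pred p < p
  pred-p<p = subst (pred p <_) (suc-pred p) ≤-refl
  n≡ : p * suc m′ + 0 ≡ p * m′ + suc (pred p)
  n≡ = begin
    p * suc m′ + 0          ≡⟨ +-identityʳ (p * suc m′) ⟩
    p * suc m′              ≡⟨ *-suc p m′ ⟩
    p + p * m′              ≡⟨ +-comm p (p * m′) ⟩
    p * m′ + p              ≡⟨ cong (_+_ (p * m′)) (suc-pred p) ⟨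
    p * m′ + suc (pred p)   ∎
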